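{- For an indeterminate (or any rational number) $n$, define $p = -n^4(n+1)(n^2+2n+2)(n^4+3n^3+3n^2+3n+1)$, $q = (n^2+n+1)(n^3+n^2+1)(n^6+2n^5+2n^4+2n^3+3n^2+2n+1)$, $r = n(n+1)(n^2+n+1)(n^3+n^2+1)(n^4+3n^3+3n^2+3n+1)$, $s = n(n^{10}+4n^9+8n^8+10n^7+7n^6+2n^5+n^4+2n^3+3n^2+2n+1)$. Then $pq(p^2+q^2) = -\,rs(r^2+s^2)$; equivalently, with $A=p+q$, $B=r-s$, $C=p-q$, $D=r+s$, one has $A^4 - B^4 = C^4 - D^4$. -}

module Defs where

open import Data.Rational using (ℚ; _+_; _*_; _-_; -_; 0ℚ; 1ℚ)
open import Data.Integer using (+_)
open import Data.Nat using (ℕ)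
import Data.Rational as Q

k : ℕ → ℚ
k m = Q._/_ (+ m) 1

infixr 8 _^_
_^_ : ℚ → ℕ → ℚ
x ^ ℕ.zero = 1ℚ
x ^ ℕ.suc m = x * (x ^ m)

module _ (n : ℚ) where
  p : ℚ
  p = - ((n ^ 4) * (n + 1ℚ) * ((n ^ 2) + k 2 * n + k 2)
        * ((n ^ 4) + k 3 * (n ^ 3) + k 3 * (n ^ 2) + k 3 * n + 1ℚ))

  q : ℚ
  q = ((n ^ 2) + n + 1ℚ) * ((n ^ 3) + (n ^ 2) + 1ℚ)
      * ((n ^ 6) + k 2 * (n ^ 5) + k 2 * (n ^ 4) + k 2 * (n ^ 3) + k 3 * (n ^ 2) + k 2 * n + 1ℚ)

  r : ℚ
  r = n * (n + 1ℚ) * ((n ^ 2) + n + 1ℚ) * ((n ^ 3) + (n ^ 2) + 1ℚ)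
      * ((n ^ 4) + k 3 * (n ^ 3) + k 3 * (n ^ 2) + k 3 * n + 1ℚ)

  s : ℚ
  s = n * ((n ^ 10) + k 4 * (n ^ 9) + k 8 * (n ^ 8) + k 10 * (n ^ 7) + k 7 * (n ^ 6)
          + k 2 * (n ^ 5) + (n ^ 4) + k 2 * (n ^ 3) + k 3 * (n ^ 2) + k 2 * n + 1ℚ)

module Submission where

-- The four polynomials factor into the seven polynomials
--   a = n+1, b = n²+2n+2, c = n⁴+3n³+3n²+3n+1, d = n²+n+1, e = n³+n²+1,
--   f = n⁶+2n⁵+2n⁴+2n³+3n²+2n+1, g = n¹⁰+4n⁹+…+2n+1
-- as p = -n⁴abc, q = def, r = nadec, s = ng.  Both pq(p²+q²) and
-- -rs(r²+s²) are then -n⁴acde times a cofactor, and the two cofactors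
--   bf(n⁸a²b²c² + d²e²f²)   and   g(a²c²d²e² + g²)
-- coincide as polynomials of degree 30 (checked by ring normalisation).
-- The second equation follows from the first for arbitrary p, q, r, s:
-- expanding the fourth powers, (A⁴ - B⁴) - (C⁴ - D⁴) is exactly
-- 8(pq(p²+q²) + rs(r²+s²)).

open import Defs
open import Data.Fin using (zero)
open import Data.Vec using (_∷_; [])
open import Data.Rational using (ℚ; _+_; _*_; _-_; -_; 0ℚ; 1ℚ)
open import Data.Product using (_×_; _,_)
open import Relation.Binary.PropositionalEquality using (_≡_; refl; cong; sym; module ≡-Reasoning)
import Data.Rational.Properties as ℚₚ
open import Algebra.Solver.Ring.AlmostCommutativeRing using (fromCommutativeRing)
open import Algebra.Solver.Ring.Simple (fromCommutativeRing ℚₚ.+-*-commutativeRing) ℚₚ._≟_ using (Polynomial; ⟦_⟧; var; con; _:+_; _:*_; _:-_; :-_; _:^_; _:=_; solve; prove)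

-- For literal exponents the solver's power unfolds exactly like
-- Defs._^_, so `P at n` is definitionally the expected rational expression.
ℚ[X] : Set
ℚ[X] = Polynomial 1

X : ℚ[X]
X = var zero

_at_ : ℚ[X] → ℚ → ℚ
P at n = ⟦ P ⟧ (n ∷ [])

a b c d e f g : ℚ[X]
a = X :+ con 1ℚ
b = X :^ 2 :+ con (k 2) :* X :+ con (k 2)
c = X :^ 4 :+ con (k 3) :* X :^ 3 :+ con (k 3) :* X :^ 2 :+ con (k 3) :* X :+ con 1ℚ
d = X :^ 2 :+ X :+ con 1ℚ
e = X :^ 3 :+ X :^ 2 :+ con 1ℚ
f = X :^ 6 :+ con (k 2) :* X :^ 5 :+ con (k 2) :* X :^ 4 :+ con (k 2) :* X :^ 3
      :+ con (k 3) :* X :^ 2 :+ con (k 2) :* X :+ con 1ℚ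
g = X :^ 10 :+ con (k 4) :* X :^ 9 :+ con (k 8) :* X :^ 8 :+ con (k 10) :* X :^ 7
      :+ con (k 7) :* X :^ 6 :+ con (k 2) :* X :^ 5 :+ X :^ 4 :+ con (k 2) :* X :^ 3
      :+ con (k 3) :* X :^ 2 :+ con (k 2) :* X :+ con 1ℚ

pq-factored : ∀ x A B C D E F →
  - (x ^ 4 * A * B * C) * (D * E * F) * ((- (x ^ 4 * A * B * C)) ^ 2 + (D * E * F) ^ 2)
  ≡ - (x ^ 4 * A * C * D * E) * (B * F * (x ^ 8 * A ^ 2 * B ^ 2 * C ^ 2 + D ^ 2 * E ^ 2 * F ^ 2))
pq-factored = solve 7 (λ x A B C D E F →
  (:- (x :^ 4 :* A :* B :* C)) :* (D :* E :* F) :* ((:- (x :^ 4 :* A :* B :* C)) :^ 2 :+ (D :* E :* F) :^ 2)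
  := (:- (x :^ 4 :* A :* C :* D :* E)) :* (B :* F :* (x :^ 8 :* A :^ 2 :* B :^ 2 :* C :^ 2 :+ D :^ 2 :* E :^ 2 :* F :^ 2)))
  refl

rs-factored : ∀ x A C D E G →
  - (x * A * D * E * C * (x * G) * ((x * A * D * E * C) ^ 2 + (x * G) ^ 2))
  ≡ - (x ^ 4 * A * C * D * E) * (G * (A ^ 2 * C ^ 2 * D ^ 2 * E ^ 2 + G ^ 2))
rs-factored = solve 6 (λ x A C D E G →
  :- (x :* A :* D :* E :* C :* (x :* G) :* ((x :* A :* D :* E :* C) :^ 2 :+ (x :* G) :^ 2))
  := (:- (x :^ 4 :* A :* C :* D :* E)) :* (G :* (A :^ 2 :* C :^ 2 :* D :^ 2 :* E :^ 2 :+ G :^ 2)))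
  refl

cofactor-pq cofactor-rs : ℚ[X]
cofactor-pq = b :* f :* (X :^ 8 :* a :^ 2 :* b :^ 2 :* c :^ 2 :+ d :^ 2 :* e :^ 2 :* f :^ 2)
cofactor-rs = g :* (a :^ 2 :* c :^ 2 :* d :^ 2 :* e :^ 2 :+ g :^ 2)

cofactors-agree : ∀ n → cofactor-pq at n ≡ cofactor-rs at n
cofactors-agree n = prove (n ∷ []) cofactor-pq cofactor-rs refl

pq-relation : ∀ n → p n * q n * (p n ^ 2 + q n ^ 2) ≡ - (r n * s n * (r n ^ 2 + s n ^ 2))
pq-relation n = begin
  p n * q n * (p n ^ 2 + q n ^ 2)       ≡⟨ pq-factored n A B C D E F ⟩
  common * (cofactor-pq at n)           ≡⟨ cong (common *_) (cofactors-agree n) ⟩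
  common * (cofactor-rs at n)           ≡⟨ sym (rs-factored n A C D E G) ⟩
  - (r n * s n * (r n ^ 2 + s n ^ 2))   ∎
  where
  open ≡-Reasoning
  A B C D E F G common : ℚ
  A = a at n
  B = b at n
  C = c at n
  D = d at n
  E = e at n
  F = f at n
  G = g at n
  common = - (n ^ 4 * A * C * D * E)

-- Expanding the fourth powers: the terms of even degree in the second
-- variable cancel, leaving 8 times the two expressions xy(x²+y²).
fourth-powers-expanded : ∀ P Q R S →
  (P + Q) ^ 4 - (R - S) ^ 4
  ≡ (P - Q) ^ 4 - (R + S) ^ 4 + k 8 * (P * Q * (P ^ 2 + Q ^ 2) + R * S * (R ^ 2 + S ^ 2))
fourth-powers-expanded = solve 4 (λ P Q R S →
  (P :+ Q) :^ 4 :- (R :- S) :^ 4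
  := (P :- Q) :^ 4 :- (R :+ S) :^ 4 :+ con (k 8) :* (P :* Q :* (P :^ 2 :+ Q :^ 2) :+ R :* S :* (R :^ 2 :+ S :^ 2)))
  refl

quartic-from-relation : ∀ P Q R S →
  P * Q * (P ^ 2 + Q ^ 2) ≡ - (R * S * (R ^ 2 + S ^ 2)) →
  (P + Q) ^ 4 - (R - S) ^ 4 ≡ (P - Q) ^ 4 - (R + S) ^ 4
quartic-from-relation P Q R S relation = begin
  (P + Q) ^ 4 - (R - S) ^ 4                    ≡⟨ fourth-powers-expanded P Q R S ⟩
  rest + k 8 * (P * Q * (P ^ 2 + Q ^ 2) + v)   ≡⟨ cong (λ u → rest + k 8 * (u + v)) relation ⟩
  rest + k 8 * (- v + v)                       ≡⟨ cong (λ t → rest + k 8 * t) (ℚₚ.+-inverseˡ v) ⟩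
  rest + 0ℚ                                    ≡⟨ ℚₚ.+-identityʳ rest ⟩
  rest                                         ∎
  where
  open ≡-Reasoning
  rest v : ℚ
  rest = (P - Q) ^ 4 - (R + S) ^ 4
  v = R * S * (R ^ 2 + S ^ 2)

mainTheorem2 : (n : ℚ) → (p n * q n * ((p n ^ 2) + (q n ^ 2)) ≡ - (r n * s n * ((r n ^ 2) + (s n ^ 2)))) × (((p n + q n) ^ 4) - ((r n - s n) ^ 4) ≡ ((p n - q n) ^ 4) - ((r n + s n) ^ 4))
mainTheorem2 n = pq-relation n , quartic-from-relation (p n) (q n) (r n) (s n) (pq-relation n)
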